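{- For every tableau $\mathcal T$ of order $t+1$ one has $f_{\mathcal T^*}=(f_{\mathcal T})^*$.
   Context: Let $T=\{1,\dots,t\}$, $\hat T=\{1,\dots,t+1\}$. A diagram of order $t+1$ is a tuple $(h_1,\dots,h_{t+1})$ of non-negative integers, pictured as columns $C_1,\dots,C_{t+1}$ of unit blocks; $B(i,j)$ is the block of $C_i$ at level $j\le h_i$, $R_j$ the set of blocks at level $j$. Two distinct columns of height $\ge s$ are neighbours at level $s$ if all columns strictly between have height $<s$. A column is left (resp. right) extremal if it has no neighbour to its left (resp. right) at level equal to its height. Boundary conditions (always imposed): left extremal columns have even or maximal height; right extremal columns have odd or maximal height. Tableau: at each non-empty level $j$ the extremal block of $R_j$ is its rightmost block ($j$ odd) or leftmost block ($j$ even), with no entry; $b(i,1)=i$ for non-extremal $B(i,1)$; for $j\ge1$ and non-extremal $B(i,j+1)$, $b(i,j+1)=b(k,j)$ with $C_k$ the left ($j$ odd) resp. right ($j$ even) neighbour of $C_i$ at level $j$. Functions: indeterminates $c_1,\dots,c_t,m^1,\dots,m^{t+1}$; for $i<j$ in $\hat T$, $r^i-r^j:=m^i+2m^{i+1}+\dots+2m^{j-1}+m^j$, $r^j-r^i:=-(r^i-r^j)$. $h=-\sum_{i\in T}c_im^i$. For a level $s$ with columns of height $\ge s$ indexed $u_1<\dots<u_k$: $f_{R_s}=\sum_{i=1}^{k-1}c_{b(u_i,s)}(r^{u_i}-r^{u_{i+1}})$ if $s$ is odd, $f_{R_s}=\sum_{i=2}^kc_{b(u_i,s)}(r^{u_i}-r^{u_{i-1}})$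 if $s$ is even; $f_{\mathcal T}=h+\sum_{s\ge1}f_{R_s}$. Duality: the dual of the diagram $(h_1,\dots,h_{t+1})$ is $(h_{t+1}+1,h_t+1,\dots,h_1+1)$ (column order reversed, every height increased by one), and $\mathcal T^*$ is its tableau. On functions, $*$ is the ring automorphism of $\mathbb Z[c_1,\dots,c_t,m^1,\dots,m^{t+1}]$ with $c_i^*=c_{t+1-i}$ and $(m^i)^*=-m^{t+2-i}$. -}

module Defs where

open import Data.Bool using (Bool; true; false; if_then_else_; _∧_; _∨_; not)
open import Data.Nat as ℕ using (ℕ; zero; suc; _≤_; _<_; _≤?_; _<?_; _<ᵇ_; _≡ᵇ_; _⊔_)
open import Data.Nat.Divisibility using (_∣_)
open import Data.Integer as ℤ using (ℤ; +_; -[1+_])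
open import Data.Fin as Fin using (Fin; toℕ; fromℕ<; opposite)
open import Data.Vec as Vec using (Vec; lookup)
open import Data.List as List using (List; []; _∷_; filter; upTo; map; foldr)
open import Data.Maybe using (Maybe; just; nothing; maybe)
open import Data.Product using (_×_; _,_)
open import Data.Sum using (_⊎_)
open import Relation.Nullary using (¬_; yes; no)
open import Relation.Binary.PropositionalEquality using (_≡_)

-- Diagrams of order t+1: heights (h_1,…,h_{t+1}); Vec position k (0-based)
-- is column C_{k+1}.

Diagram : ℕ → Set
Diagram t = Vec ℕ (suc t)

Even Odd : ℕ → Set
Even n = 2 ∣ n
Odd n = ¬ (2 ∣ n)

maxH : ∀ {t} → Diagram t → ℕ
maxH D = Vec.foldr _ _⊔_ 0 D

LeftExtremal : ∀ {t} → Diagram t → Fin (suc t) → Set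
LeftExtremal D i = ∀ j → j Fin.< i → lookup D j < lookup D i

RightExtremal : ∀ {t} → Diagram t → Fin (suc t) → Set
RightExtremal D i = ∀ j → i Fin.< j → lookup D j < lookup D i

Boundary : ∀ {t} → Diagram t → Set
Boundary D = ∀ i →
  (LeftExtremal D i → Even (lookup D i) ⊎ lookup D i ≡ maxH D) ×
  (RightExtremal D i → Odd (lookup D i) ⊎ lookup D i ≡ maxH D)

dual : ∀ {t} → Diagram t → Diagram t
dual D = Vec.map suc (Vec.reverse D)

-- Combinatorics of the tableau, with 1-based ℕ column indices.

-- height of column C_i (1-based; 0 outside 1..t+1, never used there)
col : ∀ {t} → Diagram t → ℕ → ℕ
col D zero = 0
col {t} D (suc i) with i <? suc t
... | yes p = lookup D (fromℕ< p)
... | no _ = 0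

level : ∀ {t} → Diagram t → ℕ → List ℕ
level {t} D s = filter (λ i → s ≤? col D i) (map suc (upTo (suc t)))

leftNb : List ℕ → ℕ → Maybe ℕ
leftNb [] i = nothing
leftNb (x ∷ []) i = nothing
leftNb (x ∷ y ∷ xs) i = if y ≡ᵇ i then just x else leftNb (y ∷ xs) i

rightNb : List ℕ → ℕ → Maybe ℕ
rightNb [] i = nothing
rightNb (x ∷ []) i = nothing
rightNb (x ∷ y ∷ xs) i = if x ≡ᵇ i then just y else rightNb (y ∷ xs) i

oddᵇ : ℕ → Bool
oddᵇ zero = false
oddᵇ (suc n) = not (oddᵇ n)

-- entry b(i,j) of the non-extremal block B(i,j) (arguments: level j, column i).
-- The value 0 is a dummy, only reached outside the domain of definition.
entry : ∀ {t} → Diagram t → ℕ → ℕ → ℕ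
entry D zero i = 0
entry D (suc zero) i = i
entry D (suc (suc j)) i =
  if oddᵇ (suc j)
  then maybe (entry D (suc j)) 0 (leftNb (level D (suc j)) i)
  else maybe (entry D (suc j)) 0 (rightNb (level D (suc j)) i)

-- All functions occurring are Z-linear combinations of the
-- monomials c_a m^l; such an element of Z[c_1..c_t,m^1..m^{t+1}] is
-- represented by its coefficient array: P a l = coefficient of
-- c_{a+1} m^{l+1} (0-based Fin indices).

Lin : ℕ → Set            -- linear forms in m^1..m^{t+1}
Lin t = Fin (suc t) → ℤ

Poly : ℕ → Set
Poly t = Fin t → Fin (suc t) → ℤ

_⊕_ : ∀ {t} → Poly t → Poly t → Poly t
(P ⊕ Q) a l = P a l ℤ.+ Q a l

𝟎 : ∀ {t} → Poly t
𝟎 a l = + 0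

-- c_a · L  (a 1-based)
cm : ∀ {t} → ℕ → Lin t → Poly t
cm a L b l = if suc (toℕ b) ≡ᵇ a then L l else + 0

-- coefficient of m^x in m^i + 2m^{i+1} + … + 2m^{j-1} + m^j  (i < j)
rcoef : ℕ → ℕ → ℕ → ℤ
rcoef i j x =
  if (x ≡ᵇ i) ∨ (x ≡ᵇ j) then + 1
  else if (i <ᵇ x) ∧ (x <ᵇ j) then + 2
  else + 0

-- r^i - r^j  (i, j 1-based, i ≠ j)
rdiff : ∀ {t} → ℕ → ℕ → Lin t
rdiff i j l =
  if i <ᵇ j then rcoef i j (suc (toℕ l))
  else if j <ᵇ i then ℤ.- rcoef j i (suc (toℕ l))
  else + 0

-- h = - Σ_{i∈T} c_i m^i
hPoly : ∀ {t} → Poly t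
hPoly a l = if toℕ a ≡ᵇ toℕ l then -[1+ 0 ] else + 0

pairs : List ℕ → List (ℕ × ℕ)
pairs [] = []
pairs (x ∷ []) = []
pairs (x ∷ y ∷ xs) = (x , y) ∷ pairs (y ∷ xs)

sumP : ∀ {t} → List (Poly t) → Poly t
sumP = foldr _⊕_ 𝟎

fR : ∀ {t} → Diagram t → ℕ → Poly t
fR D s =
  if oddᵇ s
  then sumP (map (λ { (u , v) → cm (entry D s u) (rdiff u v) }) (pairs (level D s)))
  else sumP (map (λ { (u , v) → cm (entry D s v) (rdiff v u) }) (pairs (level D s)))

-- f_T = h + Σ_{s ≥ 1} f_{R_s}  (levels above maxH are empty and contribute 0)
fT : ∀ {t} → Diagram t → Poly t
fT D = hPoly ⊕ sumP (map (λ s → fR D (suc s)) (upTo (maxH D)))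

-- the automorphism * : c_i ↦ c_{t+1-i}, m^i ↦ -m^{t+2-i}
star : ∀ {t} → Poly t → Poly t
star P a l = ℤ.- P (opposite a) (opposite l)

module Submission where

-- Let op(x) = t+2-x be the mirror of column indices; it sends column C_x
-- of D to column C_{op x} of the dual diagram D*, whose height is one more.
-- Hence the columns of height ≥ s+1 in D* are exactly the mirrors of the
-- columns of height ≥ s in D, in reversed order:
--   level D* (s+1) = reverse (map op (level D s)).
-- Reversal exchanges left and right neighbours, and the parity of the
-- level changes as well, so by induction on the level the entries satisfy
--   b*(op x, s+2) = t+1 - b(x, s+1)          (c_i ↦ c_{t+1-i}),
-- and the pair (u,v) of level s+1 of D reappears as (op v, op u) in level
-- s+2 of D*.  Together with r^{op u} - r^{op v} = (r^u - r^v)* this gives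
--   f_{R_{s+2}}(D*) = (f_{R_{s+1}}(D))*          for every s.
-- The lowest level of D* contains all columns, and h + f_{R_1}(D*) = h*
-- by a direct computation.  Since max height(D*) = max height(D) + 1,
-- summing over the levels proves the theorem.

open import Defs
open import Data.Nat using (ℕ; suc)
open import Data.Fin using (Fin)
open import Relation.Binary.PropositionalEquality using (_≡_)

open import Algebra.Structures using (IsCommutativeMonoid)
open import Data.Bool using (Bool; true; false; not; if_then_else_; _∧_; _∨_)
open import Data.Bool.Properties using (∨-comm; ∧-comm; if-float)
open import Data.Empty using (⊥; ⊥-elim)
open import Data.Fin as Fin using (toℕ; fromℕ<; fromℕ; inject₁; opposite)
import Data.Fin.Properties as Finₚ
open import Data.Integer using (ℤ; +_; -[1+_]; _+_; -_)
import Data.Integer.Properties as ℤₚ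
open import Data.List as List
  using (List; []; _∷_; map; filter; upTo; applyUpTo; applyDownFrom; reverse; reverseAcc)
import Data.List.Properties as Listₚ
open import Data.List.Membership.Propositional using (_∈_)
open import Data.List.Membership.Propositional.Properties
  using (∈-map⁺; ∈-map⁻; ∈-applyUpTo⁺; ∈-applyUpTo⁻)
open import Data.List.Relation.Unary.All as All using (All; []; _∷_)
import Data.List.Relation.Unary.All.Properties as Allₚ
open import Data.List.Relation.Unary.AllPairs as AllPairs using (_∷_)
open import Data.List.Relation.Unary.Any using (here; there)
import Data.List.Relation.Unary.Any.Properties as Anyₚ
open import Data.List.Relation.Unary.Unique.Propositional using (Unique)
import Data.List.Relation.Unary.Unique.Propositional.Properties as Uniqueₚ
open import Data.List.Relation.Binary.Permutation.Propositional using (↭-sym; ↭⇒↭ₛ; ↭⇒↭ₛ′)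
open import Data.List.Relation.Binary.Permutation.Propositional.Properties using (↭-reverse)
import Data.List.Relation.Binary.Permutation.Setoid.Properties as Permutationₚ
open import Data.Maybe as Maybe using (Maybe; just; nothing; maybe)
open import Data.Nat as ℕ using (zero; _∸_; _≤_; _<_; _⊔_; z≤n; s≤s; s≤s⁻¹; _≡ᵇ_; _<ᵇ_; _≤?_)
import Data.Nat.Properties as ℕₚ
open import Data.Product as Prod using (_×_; _,_; proj₁; proj₂; swap)
open import Data.Vec as Vec using (Vec; lookup; _∷ʳ_)
import Data.Vec.Properties as Vecₚ
open import Function using (_∘_; id; _⇔_; mk⇔; Equivalence)
open import Relation.Binary using (Setoid; IsEquivalence)
import Relation.Binary.Reasoning.Setoid as ≈-Reasoning
open import Relation.Binary.PropositionalEquality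
  using (refl; sym; trans; cong; cong₂; subst; _≢_; module ≡-Reasoning)
import Relation.Binary.PropositionalEquality as ≡
open import Relation.Nullary using (yes; no)
open import Relation.Nullary.Reflects using (Reflects; ofʸ; ofⁿ; fromEquivalence)
open import Relation.Unary using (Decidable)

open Equivalence using (to; from)

≡ᵇ-reflects : ∀ m n → Reflects (m ≡ n) (m ≡ᵇ n)
≡ᵇ-reflects m n = fromEquivalence (ℕₚ.≡ᵇ⇒≡ m n) (ℕₚ.≡⇒≡ᵇ m n)

≡ᵇ-refl : ∀ n → (n ≡ᵇ n) ≡ true
≡ᵇ-refl zero = refl
≡ᵇ-refl (suc n) = ≡ᵇ-refl n

reflects-⇔ : ∀ {P Q : Set} {b c} → Reflects P b → Reflects Q c →
  (P → Q) → (Q → P) → b ≡ c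
reflects-⇔ (ofʸ _) (ofʸ _) _ _ = refl
reflects-⇔ (ofʸ p) (ofⁿ ¬q) f _ = ⊥-elim (¬q (f p))
reflects-⇔ (ofⁿ ¬p) (ofʸ q) _ g = ⊥-elim (¬p (g q))
reflects-⇔ (ofⁿ _) (ofⁿ _) _ _ = refl

choice-antisym : ∀ i j (A B : ℤ) →
  (if j <ᵇ i then B else if i <ᵇ j then - A else + 0)
    ≡ - (if i <ᵇ j then A else if j <ᵇ i then - B else + 0)
choice-antisym i j A B
  with i <ᵇ j | ℕₚ.<ᵇ-reflects-< i j | j <ᵇ i | ℕₚ.<ᵇ-reflects-< j i
... | true  | ofʸ i<j | true  | ofʸ j<i = ⊥-elim (ℕₚ.<-asym i<j j<i)
... | true  | _       | false | _       = refl
... | false | _       | true  | _       = sym (ℤₚ.neg-involutive B)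
... | false | _       | false | _       = refl

if-not : ∀ {X Y : Set} (φ : X → Y) b {A B : X} {A′ B′ : Y} →
  B′ ≡ φ A → A′ ≡ φ B → (if not b then A′ else B′) ≡ φ (if b then A else B)
if-not φ true eB _ = eB
if-not φ false _ eA = eA

maybe-ext : ∀ {A : Set} {m n : Maybe A} →
  (∀ {y} → m ≡ just y → n ≡ just y) → (∀ {y} → n ≡ just y → m ≡ just y) → m ≡ n
maybe-ext {m = just y} f _ = sym (f refl)
maybe-ext {m = nothing} {nothing} _ _ = refl
maybe-ext {m = nothing} {just z} _ g with g refl
... | ()

pairs-∈ : ∀ {a xs u v} → (u , v) ∈ pairs (a ∷ xs) → u ∈ a ∷ xs × v ∈ xs
pairs-∈ {xs = _ ∷ _} (here refl) = here refl , here refl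
pairs-∈ {xs = _ ∷ _} (there m) = Prod.map there there (pairs-∈ m)

pairs-∈′ : ∀ {xs u v} → (u , v) ∈ pairs xs → u ∈ xs × v ∈ xs
pairs-∈′ {_ ∷ _} m = Prod.map id there (pairs-∈ m)

pairs-map : ∀ (f : ℕ → ℕ) xs → pairs (map f xs) ≡ map (Prod.map f f) (pairs xs)
pairs-map f [] = refl
pairs-map f (x ∷ []) = refl
pairs-map f (x ∷ y ∷ xs) = cong ((f x , f y) ∷_) (pairs-map f (y ∷ xs))

-- Reversing a list reverses the sequence of consecutive pairs and swaps
-- each of them (stated with an accumulator, as reverse is computed).
pairs-reverseAcc : ∀ a acc xs →
  pairs (reverseAcc (a ∷ acc) xs) ≡ reverseAcc (pairs (a ∷ acc)) (map swap (pairs (a ∷ xs)))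
pairs-reverseAcc a acc [] = refl
pairs-reverseAcc a acc (x ∷ xs) = pairs-reverseAcc x (a ∷ acc) xs

pairs-reverse : ∀ xs → pairs (reverse xs) ≡ reverse (map swap (pairs xs))
pairs-reverse [] = refl
pairs-reverse (a ∷ xs) = pairs-reverseAcc a [] xs

pairs-reverse-∈ : ∀ xs {u v} → (u , v) ∈ pairs (reverse xs) ⇔ (v , u) ∈ pairs xs
pairs-reverse-∈ xs {u} {v} = mk⇔ to′ from′
  where
  to′ : (u , v) ∈ pairs (reverse xs) → (v , u) ∈ pairs xs
  to′ m with _ , p∈ , refl ← ∈-map⁻ swap (Anyₚ.reverse⁻ (subst ((u , v) ∈_) (pairs-reverse xs) m)) = p∈
  from′ : (v , u) ∈ pairs xs → (u , v) ∈ pairs (reverse xs)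
  from′ m = subst ((u , v) ∈_) (sym (pairs-reverse xs)) (Anyₚ.reverse⁺ (∈-map⁺ swap m))

pairs-reverse-map : ∀ (f : ℕ → ℕ) xs →
  pairs (reverse (map f xs)) ≡ reverse (map (swap ∘ Prod.map f f) (pairs xs))
pairs-reverse-map f xs = trans (pairs-reverse (map f xs))
  (cong reverse (trans (cong (map swap) (pairs-map f xs)) (sym (Listₚ.map-∘ (pairs xs)))))

leftNb-spec : ∀ {xs} → Unique xs → ∀ {x y} → leftNb xs x ≡ just y ⇔ (y , x) ∈ pairs xs
leftNb-spec {[]} _ = mk⇔ (λ ()) (λ ())
leftNb-spec {_ ∷ []} _ = mk⇔ (λ ()) (λ ())
leftNb-spec {a ∷ b ∷ xs} (_ ∷ u) {x} with b ≡ᵇ x | ≡ᵇ-reflects b x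
... | true | ofʸ refl = mk⇔ (λ { refl → here refl }) λ
  { (here refl) → refl
  ; (there m) → ⊥-elim (All.lookup (AllPairs.head u) (proj₂ (pairs-∈ m)) refl) }
... | false | ofⁿ b≢x = mk⇔ (there ∘ to ih) λ
  { (here refl) → ⊥-elim (b≢x refl)
  ; (there m) → from ih m }
  where ih = leftNb-spec u

rightNb-spec : ∀ {xs} → Unique xs → ∀ {x y} → rightNb xs x ≡ just y ⇔ (x , y) ∈ pairs xs
rightNb-spec {[]} _ = mk⇔ (λ ()) (λ ())
rightNb-spec {_ ∷ []} _ = mk⇔ (λ ()) (λ ())
rightNb-spec {a ∷ b ∷ xs} (a∉ ∷ u) {x} with a ≡ᵇ x | ≡ᵇ-reflects a x
... | true | ofʸ refl = mk⇔ (λ { refl → here refl }) λ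
  { (here refl) → refl
  ; (there m) → ⊥-elim (All.lookup a∉ (proj₁ (pairs-∈ m)) refl) }
... | false | ofⁿ a≢x = mk⇔ (there ∘ to ih) λ
  { (here refl) → ⊥-elim (a≢x refl)
  ; (there m) → from ih m }
  where ih = rightNb-spec u

leftNb-∈ : ∀ {xs} → Unique xs → ∀ {x y} → leftNb xs x ≡ just y → y ∈ xs
leftNb-∈ u e = proj₁ (pairs-∈′ (to (leftNb-spec u) e))

rightNb-∈ : ∀ {xs} → Unique xs → ∀ {x y} → rightNb xs x ≡ just y → y ∈ xs
rightNb-∈ u e = proj₂ (pairs-∈′ (to (rightNb-spec u) e))

module ℕPermutation = Permutationₚ (≡.setoid ℕ)

unique-reverse : ∀ {xs : List ℕ} → Unique xs → Unique (reverse xs)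
unique-reverse {xs} = ℕPermutation.Unique-resp-↭ (↭⇒↭ₛ (↭-sym (↭-reverse xs)))

rightNb-reverse : ∀ {xs} → Unique xs → ∀ x → rightNb (reverse xs) x ≡ leftNb xs x
rightNb-reverse {xs} u x = maybe-ext
  (λ e → from (leftNb-spec u) (to (pairs-reverse-∈ xs) (to (rightNb-spec (unique-reverse u)) e)))
  (λ e → from (rightNb-spec (unique-reverse u)) (from (pairs-reverse-∈ xs) (to (leftNb-spec u) e)))

leftNb-reverse : ∀ {xs} → Unique xs → ∀ x → leftNb (reverse xs) x ≡ rightNb xs x
leftNb-reverse {xs} u x = begin
  leftNb (reverse xs) x                   ≡⟨ sym (rightNb-reverse (unique-reverse u) x) ⟩
  rightNb (reverse (reverse xs)) x        ≡⟨ cong (λ ys → rightNb ys x) (Listₚ.reverse-involutive xs) ⟩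
  rightNb xs x                            ∎
  where open ≡-Reasoning

leftNb-map : ∀ (f : ℕ → ℕ) {x} xs → All (λ y → f y ≡ f x → y ≡ x) xs →
  leftNb (map f xs) (f x) ≡ Maybe.map f (leftNb xs x)
leftNb-map f [] _ = refl
leftNb-map f (a ∷ []) _ = refl
leftNb-map f {x} (a ∷ b ∷ xs) (_ ∷ inj)
  with b ≡ᵇ x | ≡ᵇ-reflects b x | f b ≡ᵇ f x | ≡ᵇ-reflects (f b) (f x)
... | true  | _        | true  | _         = refl
... | true  | ofʸ refl | false | ofⁿ fb≢fx = ⊥-elim (fb≢fx refl)
... | false | ofⁿ b≢x  | true  | ofʸ fb≡fx = ⊥-elim (b≢x (All.head inj fb≡fx))
... | false | _        | false | _         = leftNb-map f (b ∷ xs) inj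

rightNb-map : ∀ (f : ℕ → ℕ) {x} xs → All (λ y → f y ≡ f x → y ≡ x) xs →
  rightNb (map f xs) (f x) ≡ Maybe.map f (rightNb xs x)
rightNb-map f [] _ = refl
rightNb-map f (a ∷ []) _ = refl
rightNb-map f {x} (a ∷ b ∷ xs) (inj-a ∷ inj)
  with a ≡ᵇ x | ≡ᵇ-reflects a x | f a ≡ᵇ f x | ≡ᵇ-reflects (f a) (f x)
... | true  | _        | true  | _         = refl
... | true  | ofʸ refl | false | ofⁿ fa≢fx = ⊥-elim (fa≢fx refl)
... | false | ofⁿ a≢x  | true  | ofʸ fa≡fx = ⊥-elim (a≢x (inj-a fa≡fx))
... | false | _        | false | _         = rightNb-map f (b ∷ xs) inj

module _ {P : ℕ → Set} (P? : Decidable P) where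

  filter-reverseAcc : ∀ acc xs →
    filter P? (reverseAcc acc xs) ≡ reverseAcc (filter P? acc) (filter P? xs)
  filter-reverseAcc acc [] = refl
  filter-reverseAcc acc (x ∷ xs) with P? x
  ... | yes px = trans (filter-reverseAcc (x ∷ acc) xs)
    (cong (λ ys → reverseAcc ys (filter P? xs)) (Listₚ.filter-accept P? px))
  ... | no ¬px = trans (filter-reverseAcc (x ∷ acc) xs)
    (cong (λ ys → reverseAcc ys (filter P? xs)) (Listₚ.filter-reject P? ¬px))

  filter-reverse : ∀ xs → filter P? (reverse xs) ≡ reverse (filter P? xs)
  filter-reverse = filter-reverseAcc []

  filter-map : ∀ (f : ℕ → ℕ) xs → filter P? (map f xs) ≡ map f (filter (P? ∘ f) xs)
  filter-map f [] = refl
  filter-map f (x ∷ xs) with P? (f x)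
  ... | yes _ = cong (f x ∷_) (filter-map f xs)
  ... | no _ = filter-map f xs

  filter-cong : ∀ {Q : ℕ → Set} (Q? : Decidable Q) {xs} →
    All (λ x → P x ⇔ Q x) xs → filter P? xs ≡ filter Q? xs
  filter-cong Q? [] = refl
  filter-cong Q? {x ∷ xs} (P⇔Q ∷ es) with P? x
  ... | yes p = trans (cong (x ∷_) (filter-cong Q? es)) (sym (Listₚ.filter-accept Q? (to P⇔Q p)))
  ... | no ¬p = trans (filter-cong Q? es) (sym (Listₚ.filter-reject Q? (¬p ∘ from P⇔Q)))

applyDownFrom-applyUpTo : ∀ {A : Set} (h g : ℕ → A) n →
  (∀ {i} → i < n → h (n ∸ suc i) ≡ g i) → applyDownFrom h n ≡ applyUpTo g n
applyDownFrom-applyUpTo h g zero _ = refl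
applyDownFrom-applyUpTo h g (suc n) hg =
  cong₂ _∷_ (hg (s≤s z≤n)) (applyDownFrom-applyUpTo h (g ∘ suc) n (hg ∘ s≤s))

pairs-applyUpTo : ∀ (f : ℕ → ℕ) n → pairs (applyUpTo f (suc n)) ≡ applyUpTo (λ i → f i , f (suc i)) n
pairs-applyUpTo f zero = refl
pairs-applyUpTo f (suc n) = cong ((f 0 , f 1) ∷_) (pairs-applyUpTo (f ∘ suc) n)

map-upTo-suc : ∀ {A : Set} (f : ℕ → A) n → map f (upTo (suc n)) ≡ f 0 ∷ map (f ∘ suc) (upTo n)
map-upTo-suc f n = trans (Listₚ.map-upTo f (suc n)) (cong (f 0 ∷_) (sym (Listₚ.map-upTo (f ∘ suc) n)))

lookup-∷ʳ-last : ∀ {A : Set} {n} (xs : Vec A n) x → lookup (xs ∷ʳ x) (fromℕ n) ≡ x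
lookup-∷ʳ-last Vec.[] x = refl
lookup-∷ʳ-last (y Vec.∷ xs) x = lookup-∷ʳ-last xs x

lookup-∷ʳ-inject₁ : ∀ {A : Set} {n} (xs : Vec A n) x i → lookup (xs ∷ʳ x) (inject₁ i) ≡ lookup xs i
lookup-∷ʳ-inject₁ (y Vec.∷ xs) x Fin.zero = refl
lookup-∷ʳ-inject₁ (y Vec.∷ xs) x (Fin.suc i) = lookup-∷ʳ-inject₁ xs x i

lookup-reverse : ∀ {A : Set} {n} (xs : Vec A n) i → lookup (Vec.reverse xs) (opposite i) ≡ lookup xs i
lookup-reverse (x Vec.∷ xs) Fin.zero = begin
  lookup (Vec.reverse (x Vec.∷ xs)) (fromℕ _)  ≡⟨ cong (λ v → lookup v _) (Vecₚ.reverse-∷ x xs) ⟩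
  lookup (Vec.reverse xs ∷ʳ x) (fromℕ _)       ≡⟨ lookup-∷ʳ-last (Vec.reverse xs) x ⟩
  x                                            ∎
  where open ≡-Reasoning
lookup-reverse (x Vec.∷ xs) (Fin.suc i) = begin
  lookup (Vec.reverse (x Vec.∷ xs)) (inject₁ (opposite i)) ≡⟨ cong (λ v → lookup v _) (Vecₚ.reverse-∷ x xs) ⟩
  lookup (Vec.reverse xs ∷ʳ x) (inject₁ (opposite i))      ≡⟨ lookup-∷ʳ-inject₁ (Vec.reverse xs) x (opposite i) ⟩
  lookup (Vec.reverse xs) (opposite i)                     ≡⟨ lookup-reverse xs i ⟩
  lookup xs i                                              ∎
  where open ≡-Reasoning

vecMax-toList : ∀ {n} (xs : Vec ℕ n) → Vec.foldr _ _⊔_ 0 xs ≡ List.foldr _⊔_ 0 (Vec.toList xs)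
vecMax-toList Vec.[] = refl
vecMax-toList (x Vec.∷ xs) = cong (x ⊔_) (vecMax-toList xs)

maxH-reverse : ∀ {t} (D : Diagram t) → maxH (Vec.reverse D) ≡ maxH D
maxH-reverse D = begin
  maxH (Vec.reverse D)                                 ≡⟨ vecMax-toList (Vec.reverse D) ⟩
  List.foldr _⊔_ 0 (Vec.toList (Vec.reverse D))       ≡⟨ cong (List.foldr _⊔_ 0) (Vecₚ.toList-reverse D) ⟩
  List.foldr _⊔_ 0 (reverse (Vec.toList D))           ≡⟨ ℕPermutation.foldr-commMonoid ℕₚ.⊔-0-isCommutativeMonoid
                                                           (↭⇒↭ₛ (↭-reverse (Vec.toList D))) ⟩
  List.foldr _⊔_ 0 (Vec.toList D)                     ≡⟨ sym (vecMax-toList D) ⟩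
  maxH D                                               ∎
  where open ≡-Reasoning

maxH-map-suc : ∀ {t} (D : Diagram t) → maxH (Vec.map suc D) ≡ suc (maxH D)
maxH-map-suc (x Vec.∷ Vec.[]) = cong suc (sym (ℕₚ.⊔-identityʳ x))
maxH-map-suc (x Vec.∷ y Vec.∷ ys) = cong (suc x ⊔_) (maxH-map-suc (y Vec.∷ ys))

maxH-dual : ∀ {t} (D : Diagram t) → maxH (dual D) ≡ suc (maxH D)
maxH-dual D = begin
  maxH (Vec.map suc (Vec.reverse D))  ≡⟨ maxH-map-suc (Vec.reverse D) ⟩
  suc (maxH (Vec.reverse D))          ≡⟨ cong suc (maxH-reverse D) ⟩
  suc (maxH D)                        ∎
  where open ≡-Reasoning

module PolyAlgebra (t : ℕ) where

  infix 4 _≈_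
  _≈_ : Poly t → Poly t → Set
  P ≈ Q = ∀ a l → P a l ≡ Q a l

  ≈-isEquivalence : IsEquivalence _≈_
  ≈-isEquivalence = record
    { refl = λ _ _ → refl
    ; sym = λ P≈Q a l → sym (P≈Q a l)
    ; trans = λ P≈Q Q≈R a l → trans (P≈Q a l) (Q≈R a l)
    }

  polySetoid : Setoid _ _
  polySetoid = record { isEquivalence = ≈-isEquivalence }

  ⊕-isCommutativeMonoid : IsCommutativeMonoid _≈_ _⊕_ 𝟎
  ⊕-isCommutativeMonoid = record
    { isMonoid = record
      { isSemigroup = record
        { isMagma = record
          { isEquivalence = ≈-isEquivalence
          ; ∙-cong = λ P≈P′ Q≈Q′ a l → cong₂ _+_ (P≈P′ a l) (Q≈Q′ a l)
          }
        ; assoc = λ P Q R a l → ℤₚ.+-assoc (P a l) (Q a l) (R a l)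
        }
      ; identity = (λ P a l → ℤₚ.+-identityˡ (P a l)) , (λ P a l → ℤₚ.+-identityʳ (P a l))
      }
    ; comm = λ P Q a l → ℤₚ.+-comm (P a l) (Q a l)
    }

  open IsCommutativeMonoid ⊕-isCommutativeMonoid public using (∙-cong; assoc)
  open IsEquivalence ≈-isEquivalence public using () renaming (refl to ≈-refl; sym to ≈-sym)

  module PolyPermutation = Permutationₚ polySetoid

  sumP-reverse : ∀ Ps → sumP (reverse Ps) ≈ sumP Ps
  sumP-reverse Ps = PolyPermutation.foldr-commMonoid ⊕-isCommutativeMonoid
    (↭⇒↭ₛ′ ≈-isEquivalence (↭-reverse Ps))

  sumP-cong : ∀ {A : Set} {F G : A → Poly t} xs →
    (∀ {x} → x ∈ xs → F x ≈ G x) → sumP (map F xs) ≈ sumP (map G xs)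
  sumP-cong [] _ = ≈-refl
  sumP-cong (x ∷ xs) F≈G = ∙-cong (F≈G (here refl)) (sumP-cong xs (F≈G ∘ there))

  star-⊕ : ∀ P Q → star (P ⊕ Q) ≈ star P ⊕ star Q
  star-⊕ P Q a l = ℤₚ.neg-distrib-+ (P (opposite a) (opposite l)) (Q (opposite a) (opposite l))

  star-sumP : ∀ {A : Set} (F : A → Poly t) xs → star (sumP (map F xs)) ≈ sumP (map (star ∘ F) xs)
  star-sumP F [] = ≈-refl
  star-sumP F (x ∷ xs) a l = trans (star-⊕ (F x) (sumP (map F xs)) a l)
    (cong (λ z → - F x (opposite a) (opposite l) + z) (star-sumP F xs a l))

  sumP-vanishing : ∀ (F : ℕ → Poly t) n a l → (∀ i → F i a l ≡ + 0) → sumP (applyUpTo F n) a l ≡ + 0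
  sumP-vanishing F zero a l _ = refl
  sumP-vanishing F (suc n) a l F≡0 =
    cong₂ _+_ (F≡0 0) (sumP-vanishing (F ∘ suc) n a l (F≡0 ∘ suc))

  sumP-single : ∀ (F : ℕ → Poly t) n a l k → k < n →
    (∀ i → i ≢ k → F i a l ≡ + 0) → sumP (applyUpTo F n) a l ≡ F k a l
  sumP-single F (suc n) a l zero _ F≡0 = begin
    F 0 a l + sumP (applyUpTo (F ∘ suc) n) a l
      ≡⟨ cong (λ z → F 0 a l + z) (sumP-vanishing (F ∘ suc) n a l (λ i → F≡0 (suc i) (λ ()))) ⟩
    F 0 a l + + 0  ≡⟨ ℤₚ.+-identityʳ (F 0 a l) ⟩
    F 0 a l        ∎
    where open ≡-Reasoning
  sumP-single F (suc n) a l (suc k) k<n F≡0 = begin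
    F 0 a l + sumP (applyUpTo (F ∘ suc) n) a l
      ≡⟨ cong₂ _+_ (F≡0 0 (λ ()))
                   (sumP-single (F ∘ suc) n a l k (s≤s⁻¹ k<n) (λ i i≢k → F≡0 (suc i) (i≢k ∘ ℕₚ.suc-injective))) ⟩
    + 0 + F (suc k) a l  ≡⟨ ℤₚ.+-identityˡ (F (suc k) a l) ⟩
    F (suc k) a l        ∎
    where open ≡-Reasoning

-- r^{i+1} - r^{j+1}, evaluated at m^{x+1}; for positive indices
-- rdiff (suc i) (suc j) l is rdiffAt i j (toℕ l) by definition.
rdiffAt : ℕ → ℕ → ℕ → ℤ
rdiffAt i j x = if i <ᵇ j then rcoef i j x else if j <ᵇ i then - rcoef j i x else + 0

<ᵇ-suc : ∀ a → (a <ᵇ suc a) ≡ true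
<ᵇ-suc zero = refl
<ᵇ-suc (suc a) = <ᵇ-suc a

rdiff-adjacent : ∀ {t} a (l : Fin (suc t)) → rdiff {t} (suc a) (suc (suc a)) l ≡ rcoef a (suc a) (toℕ l)
rdiff-adjacent a l =
  cong (λ c → if c then rcoef a (suc a) (toℕ l) else if suc a <ᵇ a then - rcoef (suc a) a (toℕ l) else + 0)
       (<ᵇ-suc a)

boundary-coefficient : ∀ a l →
  (if a ≡ᵇ l then -[1+ 0 ] else + 0) + rcoef a (suc a) l ≡ (if suc a ≡ᵇ l then + 1 else + 0)
boundary-coefficient zero zero = refl
boundary-coefficient zero (suc zero) = refl
boundary-coefficient zero (suc (suc l)) = refl
boundary-coefficient (suc a) zero = refl
boundary-coefficient (suc a) (suc l) = boundary-coefficient a l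

-- On odd levels the first block of a consecutive pair (u , v) carries
-- the label, on even levels the second; orient lists that block first.
orient : Bool → ℕ × ℕ → ℕ × ℕ
orient true p = p
orient false p = swap p

pairTerm : ∀ {t} → Diagram t → ℕ → ℕ × ℕ → Poly t
pairTerm E s (w , w′) = cm (entry E s w) (rdiff w w′)

fR-orient : ∀ {t} (E : Diagram t) s →
  fR E s ≡ sumP (map (pairTerm E s ∘ orient (oddᵇ s)) (pairs (level E s)))
fR-orient E s = by-parity (oddᵇ s)
  where
  by-parity : ∀ b → (if b then sumP (map (pairTerm E s) (pairs (level E s)))
                            else sumP (map (pairTerm E s ∘ swap) (pairs (level E s))))
                    ≡ sumP (map (pairTerm E s ∘ orient b) (pairs (level E s)))
  by-parity true = refl
  by-parity false = refl

module Mirror (t : ℕ) where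

  open PolyAlgebra t

  IsColumn : ℕ → Set
  IsColumn zero = ⊥
  IsColumn (suc k) = k ≤ t

  mirrorColumn : ℕ → ℕ
  mirrorColumn zero = zero
  mirrorColumn (suc k) = suc (t ∸ k)

  -- c_b ↦ c_{t+1-b}; the dummy label 0 of extremal blocks is fixed
  mirrorLabel : ℕ → ℕ
  mirrorLabel zero = zero
  mirrorLabel (suc b) = t ∸ b

  mirrorColumn-injective : ∀ {x y} → IsColumn x → IsColumn y → mirrorColumn x ≡ mirrorColumn y → x ≡ y
  mirrorColumn-injective {suc i} {suc j} i≤t j≤t e = cong suc (ℕₚ.∸-cancelˡ-≡ i≤t j≤t (ℕₚ.suc-injective e))

  ≡ᵇ-reflect : ∀ {x y} → x ≤ t → y ≤ t → (t ∸ x ≡ᵇ t ∸ y) ≡ (x ≡ᵇ y)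
  ≡ᵇ-reflect {x} {y} x≤t y≤t = reflects-⇔ (≡ᵇ-reflects (t ∸ x) (t ∸ y)) (≡ᵇ-reflects x y)
    (ℕₚ.∸-cancelˡ-≡ x≤t y≤t) (cong (t ∸_))

  <ᵇ-reflect : ∀ {x} y → x ≤ t → (t ∸ x <ᵇ t ∸ y) ≡ (y <ᵇ x)
  <ᵇ-reflect {x} y x≤t = reflects-⇔ (ℕₚ.<ᵇ-reflects-< (t ∸ x) (t ∸ y)) (ℕₚ.<ᵇ-reflects-< y x)
    ℕₚ.∸-cancelʳ-< (λ y<x → ℕₚ.∸-monoʳ-< y<x x≤t)

  rcoef-reflect : ∀ {i j x} → i ≤ t → j ≤ t → x ≤ t → rcoef (t ∸ j) (t ∸ i) (t ∸ x) ≡ rcoef i j x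
  rcoef-reflect {i} {j} {x} i≤t j≤t x≤t = cong₂ (λ p q → if p then + 1 else if q then + 2 else + 0)
    (trans (cong₂ _∨_ (≡ᵇ-reflect x≤t j≤t) (≡ᵇ-reflect x≤t i≤t)) (∨-comm (x ≡ᵇ j) (x ≡ᵇ i)))
    (trans (cong₂ _∧_ (<ᵇ-reflect x j≤t) (<ᵇ-reflect i x≤t)) (∧-comm (x <ᵇ j) (i <ᵇ x)))

  rdiffAt-reflect : ∀ {i j x} → i ≤ t → j ≤ t → x ≤ t → rdiffAt (t ∸ i) (t ∸ j) (t ∸ x) ≡ - rdiffAt i j x
  rdiffAt-reflect {i} {j} {x} i≤t j≤t x≤t
    rewrite <ᵇ-reflect j i≤t | <ᵇ-reflect i j≤t | rcoef-reflect j≤t i≤t x≤t | rcoef-reflect i≤t j≤t x≤t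
    = choice-antisym i j (rcoef i j x) (rcoef j i x)

  toℕ-opposite : ∀ (l : Fin (suc t)) → t ∸ toℕ (opposite l) ≡ toℕ l
  toℕ-opposite l = trans (cong (t ∸_) (Finₚ.opposite-prop l)) (ℕₚ.m∸[m∸n]≡n (s≤s⁻¹ (Finₚ.toℕ<n l)))

  rdiff-mirror : ∀ {u w} → IsColumn u → IsColumn w → ∀ l →
    rdiff {t} (mirrorColumn u) (mirrorColumn w) l ≡ - rdiff {t} u w (opposite l)
  rdiff-mirror {suc i} {suc j} i≤t j≤t l = begin
    rdiffAt (t ∸ i) (t ∸ j) (toℕ l)                  ≡⟨ cong (rdiffAt (t ∸ i) (t ∸ j)) (sym (toℕ-opposite l)) ⟩
    rdiffAt (t ∸ i) (t ∸ j) (t ∸ toℕ (opposite l))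
      ≡⟨ rdiffAt-reflect {i} {j} {toℕ (opposite l)} i≤t j≤t (s≤s⁻¹ (Finₚ.toℕ<n (opposite l))) ⟩
    - rdiffAt i j (toℕ (opposite l))                 ∎
    where open ≡-Reasoning

  label-mirror : ∀ (a : Fin t) b → (suc (toℕ a) ≡ᵇ mirrorLabel b) ≡ (suc (toℕ (opposite a)) ≡ᵇ b)
  label-mirror a zero = refl
  label-mirror a (suc b) = reflects-⇔ (≡ᵇ-reflects (suc (toℕ a)) (t ∸ b)) (≡ᵇ-reflects (toℕ (opposite a)) b)
    forth back
    where
    opp : toℕ (opposite a) ≡ t ∸ suc (toℕ a)
    opp = Finₚ.opposite-prop a
    forth : suc (toℕ a) ≡ t ∸ b → toℕ (opposite a) ≡ b
    forth e = trans opp (trans (cong (t ∸_) e) (ℕₚ.m∸[m∸n]≡n b≤t))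
      where
      b≤t : b ≤ t
      b≤t = ℕₚ.<⇒≤ (ℕₚ.m∸n≢0⇒n<m (ℕₚ.1+n≢0 ∘ trans e))
    back : toℕ (opposite a) ≡ b → suc (toℕ a) ≡ t ∸ b
    back e = trans (sym (ℕₚ.m∸[m∸n]≡n (Finₚ.toℕ<n a))) (cong (t ∸_) (trans (sym opp) e))

  cm-mirror : ∀ b {L L′ : Lin t} (a : Fin t) l → L l ≡ - L′ (opposite l) →
    cm (mirrorLabel b) L a l ≡ - cm b L′ (opposite a) (opposite l)
  cm-mirror b {L} {L′} a l L≡-L′ = begin
    (if suc (toℕ a) ≡ᵇ mirrorLabel b then L l else + 0) ≡⟨ cong (λ c → if c then L l else + 0) (label-mirror a b) ⟩
    (if c then L l else + 0)                            ≡⟨ cong (λ z → if c then z else + 0) L≡-L′ ⟩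
    (if c then - L′ (opposite l) else + 0)              ≡⟨ sym (if-float -_ c) ⟩
    - (if c then L′ (opposite l) else + 0)              ∎
    where
    open ≡-Reasoning
    c = suc (toℕ (opposite a)) ≡ᵇ b

  columns : List ℕ
  columns = map suc (upTo (suc t))

  columns-unique : Unique columns
  columns-unique = Uniqueₚ.map⁺ ℕₚ.suc-injective (Uniqueₚ.upTo⁺ (suc t))

  columns-are-columns : All IsColumn columns
  columns-are-columns = Allₚ.map⁺ (All.map s≤s⁻¹ (Allₚ.all-upTo (suc t)))

  level-unique : ∀ (E : Diagram t) s → Unique (level E s)
  level-unique E s = Uniqueₚ.filter⁺ (λ i → s ≤? col E i) columns-unique

  level-columns : ∀ (E : Diagram t) s → All IsColumn (level E s)
  level-columns E s = Allₚ.filter⁺ (λ i → s ≤? col E i) columns-are-columns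

  level-zero : ∀ (E : Diagram t) → level E 0 ≡ columns
  level-zero E = Listₚ.filter-all (λ i → 0 ≤? col E i) (All.tabulate (λ _ → z≤n))

  columns-mirror : reverse (map mirrorColumn columns) ≡ columns
  columns-mirror = begin
    reverse (map mirrorColumn (map suc (upTo (suc t))))   ≡⟨ cong reverse (sym (Listₚ.map-∘ (upTo (suc t)))) ⟩
    reverse (map (mirrorColumn ∘ suc) (upTo (suc t)))     ≡⟨ cong reverse (Listₚ.map-upTo (mirrorColumn ∘ suc) (suc t)) ⟩
    reverse (applyUpTo (mirrorColumn ∘ suc) (suc t))      ≡⟨ Listₚ.reverse-applyUpTo (mirrorColumn ∘ suc) (suc t) ⟩
    applyDownFrom (mirrorColumn ∘ suc) (suc t)            ≡⟨ applyDownFrom-applyUpTo (mirrorColumn ∘ suc) suc (suc t)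
                                                               (λ i<1+t → cong suc (ℕₚ.m∸[m∸n]≡n (s≤s⁻¹ i<1+t))) ⟩
    applyUpTo suc (suc t)                                 ≡⟨ sym (Listₚ.map-upTo suc (suc t)) ⟩
    map suc (upTo (suc t))                                ∎
    where open ≡-Reasoning

  pairs-columns : pairs columns ≡ applyUpTo (λ i → suc i , suc (suc i)) t
  pairs-columns = trans (cong pairs (Listₚ.map-upTo suc (suc t))) (pairs-applyUpTo suc t)

  leftNb-columns : ∀ j → j ≤ t → maybe id 0 (leftNb columns (suc j)) ≡ j
  leftNb-columns zero _ with leftNb columns 1 in e
  ... | nothing = refl
  ... | just y = ⊥-elim (no-pair (∈-applyUpTo⁻ _ (subst ((y , 1) ∈_) pairs-columns y1∈)))
    where
    y1∈ : (y , 1) ∈ pairs columns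
    y1∈ = to (leftNb-spec columns-unique) e
    no-pair : Prod.∃ (λ i → i < t × (y , 1) ≡ (suc i , suc (suc i))) → ⊥
    no-pair (_ , _ , ())
  leftNb-columns (suc j) j<t = cong (maybe id 0) (from (leftNb-spec columns-unique)
    (subst ((suc j , suc (suc j)) ∈_) (sym pairs-columns) (∈-applyUpTo⁺ (λ i → suc i , suc (suc i)) j<t)))

  col-lookup : ∀ (E : Diagram t) k (k<1+t : k < suc t) → col E (suc k) ≡ lookup E (fromℕ< k<1+t)
  col-lookup E k k<1+t with k ℕ.<? suc t
  ... | yes k<1+t′ = cong (lookup E) (Finₚ.fromℕ<-cong k k refl k<1+t′ k<1+t)
  ... | no k≮1+t = ⊥-elim (k≮1+t k<1+t)

  module Dual (D : Diagram t) where

    col-dual : ∀ {x} → IsColumn x → col (dual D) (mirrorColumn x) ≡ suc (col D x)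
    col-dual {suc k} k≤t = begin
      col (dual D) (suc (t ∸ k))                           ≡⟨ col-lookup (dual D) (t ∸ k) q ⟩
      lookup (Vec.map suc (Vec.reverse D)) (fromℕ< q)      ≡⟨ Vecₚ.lookup-map (fromℕ< q) suc (Vec.reverse D) ⟩
      suc (lookup (Vec.reverse D) (fromℕ< q))              ≡⟨ cong (λ i → suc (lookup (Vec.reverse D) i)) q≡opp ⟩
      suc (lookup (Vec.reverse D) (opposite (fromℕ< p)))   ≡⟨ cong suc (lookup-reverse D (fromℕ< p)) ⟩
      suc (lookup D (fromℕ< p))                            ≡⟨ cong suc (sym (col-lookup D k p)) ⟩
      suc (col D (suc k))                                  ∎
      where
      open ≡-Reasoning
      p : k < suc t
      p = s≤s k≤t
      q : t ∸ k < suc t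
      q = s≤s (ℕₚ.m∸n≤m t k)
      q≡opp : fromℕ< q ≡ opposite (fromℕ< p)
      q≡opp = Finₚ.toℕ-injective (trans (Finₚ.toℕ-fromℕ< q)
        (sym (trans (Finₚ.opposite-prop (fromℕ< p)) (cong (t ∸_) (Finₚ.toℕ-fromℕ< p)))))

    level-dual : ∀ s → level (dual D) (suc s) ≡ reverse (map mirrorColumn (level D s))
    level-dual s = begin
      filter P* columns                                            ≡⟨ cong (filter P*) (sym columns-mirror) ⟩
      filter P* (reverse (map mirrorColumn columns))               ≡⟨ filter-reverse P* (map mirrorColumn columns) ⟩
      reverse (filter P* (map mirrorColumn columns))               ≡⟨ cong reverse (filter-map P* mirrorColumn columns) ⟩
      reverse (map mirrorColumn (filter (P* ∘ mirrorColumn) columns))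
        ≡⟨ cong (reverse ∘ map mirrorColumn) (filter-cong (P* ∘ mirrorColumn) P (All.map heights columns-are-columns)) ⟩
      reverse (map mirrorColumn (filter P columns))                ∎
      where
      open ≡-Reasoning
      P* = λ i → suc s ≤? col (dual D) i
      P = λ i → s ≤? col D i
      heights : ∀ {x} → IsColumn x → suc s ≤ col (dual D) (mirrorColumn x) ⇔ s ≤ col D x
      heights cx rewrite col-dual cx = mk⇔ s≤s⁻¹ s≤s

    level-dual-one : level (dual D) 1 ≡ columns
    level-dual-one = trans (level-dual 0) (trans (cong (reverse ∘ map mirrorColumn) (level-zero D)) columns-mirror)

    mirrored-level-unique : ∀ s → Unique (map mirrorColumn (level D s))
    mirrored-level-unique s = subst Unique (Listₚ.reverse-involutive _)
      (unique-reverse (subst Unique (level-dual s) (level-unique (dual D) (suc s))))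

    dual-rightNb : ∀ s {x} → IsColumn x →
      rightNb (level (dual D) (suc s)) (mirrorColumn x) ≡ Maybe.map mirrorColumn (leftNb (level D s) x)
    dual-rightNb s {x} cx = begin
      rightNb (level (dual D) (suc s)) (mirrorColumn x)
        ≡⟨ cong (λ L → rightNb L (mirrorColumn x)) (level-dual s) ⟩
      rightNb (reverse (map mirrorColumn (level D s))) (mirrorColumn x)
        ≡⟨ rightNb-reverse (mirrored-level-unique s) (mirrorColumn x) ⟩
      leftNb (map mirrorColumn (level D s)) (mirrorColumn x)
        ≡⟨ leftNb-map mirrorColumn (level D s) (All.map (λ cy → mirrorColumn-injective cy cx) (level-columns D s)) ⟩
      Maybe.map mirrorColumn (leftNb (level D s) x)
        ∎
      where open ≡-Reasoning

    dual-leftNb : ∀ s {x} → IsColumn x →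
      leftNb (level (dual D) (suc s)) (mirrorColumn x) ≡ Maybe.map mirrorColumn (rightNb (level D s) x)
    dual-leftNb s {x} cx = begin
      leftNb (level (dual D) (suc s)) (mirrorColumn x)
        ≡⟨ cong (λ L → leftNb L (mirrorColumn x)) (level-dual s) ⟩
      leftNb (reverse (map mirrorColumn (level D s))) (mirrorColumn x)
        ≡⟨ leftNb-reverse (mirrored-level-unique s) (mirrorColumn x) ⟩
      rightNb (map mirrorColumn (level D s)) (mirrorColumn x)
        ≡⟨ rightNb-map mirrorColumn (level D s) (All.map (λ cy → mirrorColumn-injective cy cx) (level-columns D s)) ⟩
      Maybe.map mirrorColumn (rightNb (level D s) x)
        ∎
      where open ≡-Reasoning

    maybe-mirror : ∀ {F G : ℕ → ℕ} m → (∀ {y} → m ≡ just y → F (mirrorColumn y) ≡ mirrorLabel (G y)) →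
      maybe F 0 (Maybe.map mirrorColumn m) ≡ mirrorLabel (maybe G 0 m)
    maybe-mirror (just y) FG = FG refl
    maybe-mirror nothing _ = refl

    entry-mirror : ∀ s {x} → IsColumn x →
      entry (dual D) (suc (suc s)) (mirrorColumn x) ≡ mirrorLabel (entry D (suc s) x)
    entry-mirror zero {suc k} k≤t = begin
      maybe id 0 (leftNb (level (dual D) 1) (suc (t ∸ k)))
        ≡⟨ cong (λ L → maybe id 0 (leftNb L (suc (t ∸ k)))) level-dual-one ⟩
      maybe id 0 (leftNb columns (suc (t ∸ k)))             ≡⟨ leftNb-columns (t ∸ k) (ℕₚ.m∸n≤m t k) ⟩
      t ∸ k                                                 ∎
      where open ≡-Reasoning
    -- The parity of the level flips under duality, so an entry of D* read
    -- off a right neighbour mirrors the entry of D read off a left one, and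
    -- vice versa.
    entry-mirror (suc s) {x} cx = if-not mirrorLabel (oddᵇ (suc s)) via-right via-left
      where
      L = level D (suc s)
      L* = level (dual D) (suc (suc s))
      F = entry (dual D) (suc (suc s))
      G = entry D (suc s)
      neighbour-mirror : ∀ {y} → y ∈ L → F (mirrorColumn y) ≡ mirrorLabel (G y)
      neighbour-mirror y∈L = entry-mirror s (All.lookup (level-columns D (suc s)) y∈L)
      via-right : maybe F 0 (rightNb L* (mirrorColumn x)) ≡ mirrorLabel (maybe G 0 (leftNb L x))
      via-right = trans (cong (maybe F 0) (dual-rightNb (suc s) cx))
        (maybe-mirror (leftNb L x) (neighbour-mirror ∘ leftNb-∈ (level-unique D (suc s))))
      via-left : maybe F 0 (leftNb L* (mirrorColumn x)) ≡ mirrorLabel (maybe G 0 (rightNb L x))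
      via-left = trans (cong (maybe F 0) (dual-leftNb (suc s) cx))
        (maybe-mirror (rightNb L x) (neighbour-mirror ∘ rightNb-∈ (level-unique D (suc s))))

    pairTerm-mirror : ∀ s {w w′} → IsColumn w → IsColumn w′ →
      pairTerm (dual D) (suc (suc s)) (mirrorColumn w , mirrorColumn w′) ≈ star (pairTerm D (suc s) (w , w′))
    pairTerm-mirror s {w} {w′} cw cw′ a l = begin
      cm (entry (dual D) (suc (suc s)) (mirrorColumn w)) (rdiff (mirrorColumn w) (mirrorColumn w′)) a l
        ≡⟨ cong (λ b → cm b (rdiff (mirrorColumn w) (mirrorColumn w′)) a l) (entry-mirror s cw) ⟩
      cm (mirrorLabel (entry D (suc s) w)) (rdiff (mirrorColumn w) (mirrorColumn w′)) a l
        ≡⟨ cm-mirror (entry D (suc s) w) {rdiff (mirrorColumn w) (mirrorColumn w′)} {rdiff w w′} a l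
                     (rdiff-mirror cw cw′ l) ⟩
      - cm (entry D (suc s) w) (rdiff w w′) (opposite a) (opposite l)
        ∎
      where open ≡-Reasoning

    fR-mirror : ∀ s → fR (dual D) (suc (suc s)) ≈ star (fR D (suc s))
    fR-mirror s = begin
      fR (dual D) (suc (suc s))
        ≡⟨ fR-orient (dual D) (suc (suc s)) ⟩
      sumP (map T*′ (pairs (level (dual D) (suc (suc s)))))
        ≡⟨ cong (λ M → sumP (map T*′ (pairs M))) (level-dual (suc s)) ⟩
      sumP (map T*′ (pairs (reverse (map mirrorColumn L))))
        ≡⟨ cong (sumP ∘ map T*′) (pairs-reverse-map mirrorColumn L) ⟩
      sumP (map T*′ (reverse (map mirrorPair (pairs L))))
        ≡⟨ cong sumP (Listₚ.reverse-map T*′ (map mirrorPair (pairs L))) ⟩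
      sumP (reverse (map T*′ (map mirrorPair (pairs L))))
        ≈⟨ sumP-reverse (map T*′ (map mirrorPair (pairs L))) ⟩
      sumP (map T*′ (map mirrorPair (pairs L)))
        ≡⟨ cong sumP (sym (Listₚ.map-∘ (pairs L))) ⟩
      sumP (map (T*′ ∘ mirrorPair) (pairs L))
        ≈⟨ sumP-cong (pairs L) (λ p∈ → term-mirror (oddᵇ (suc s)) (pair-columns p∈)) ⟩
      sumP (map (star ∘ T′) (pairs L))
        ≈⟨ ≈-sym (star-sumP T′ (pairs L)) ⟩
      star (sumP (map T′ (pairs L)))
        ≡⟨ cong star (sym (fR-orient D (suc s))) ⟩
      star (fR D (suc s))
        ∎
      where
      open ≈-Reasoning polySetoid
      L = level D (suc s)
      T′ = pairTerm D (suc s) ∘ orient (oddᵇ (suc s))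
      T*′ = pairTerm (dual D) (suc (suc s)) ∘ orient (not (oddᵇ (suc s)))
      mirrorPair = swap ∘ Prod.map mirrorColumn mirrorColumn
      pair-columns : ∀ {u v} → (u , v) ∈ pairs L → IsColumn u × IsColumn v
      pair-columns p∈ = Prod.map column column (pairs-∈′ p∈)
        where
        column : ∀ {y} → y ∈ L → IsColumn y
        column = All.lookup (level-columns D (suc s))
      -- the parity flips, so the labelled block of a mirrored pair is the
      -- mirror of the labelled block of the pair
      term-mirror : ∀ b {u v} → IsColumn u × IsColumn v →
        pairTerm (dual D) (suc (suc s)) (orient (not b) (mirrorPair (u , v)))
          ≈ star (pairTerm D (suc s) (orient b (u , v)))
      term-mirror true (cu , cv) = pairTerm-mirror s cu cv
      term-mirror false (cu , cv) = pairTerm-mirror s cv cu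

    -- The lowest level of D* contains every column, so
    -- f_{R_1}(D*) = Σ_a c_a (r^a - r^{a+1}) = Σ_a c_a (m^a + m^{a+1}).
    fR-dual-one : ∀ a l → fR (dual D) 1 a l ≡ rdiff (suc (toℕ a)) (suc (suc (toℕ a))) l
    fR-dual-one a l = begin
      sumP (map (pairTerm (dual D) 1) (pairs (level (dual D) 1))) a l
        ≡⟨ cong (λ L → sumP (map (pairTerm (dual D) 1) (pairs L)) a l) level-dual-one ⟩
      sumP (map (pairTerm (dual D) 1) (pairs columns)) a l
        ≡⟨ cong (λ ps → sumP (map (pairTerm (dual D) 1) ps) a l) pairs-columns ⟩
      sumP (map (pairTerm (dual D) 1) (applyUpTo (λ i → suc i , suc (suc i)) t)) a l
        ≡⟨ cong (λ Ps → sumP Ps a l) (Listₚ.map-applyUpTo _ (pairTerm (dual D) 1) t) ⟩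
      sumP (applyUpTo F t) a l
        ≡⟨ sumP-single F t a l (toℕ a) (Finₚ.toℕ<n a) off-diagonal ⟩
      F (toℕ a) a l
        ≡⟨ cong (λ c → if c then rdiff (suc (toℕ a)) (suc (suc (toℕ a))) l else + 0) (≡ᵇ-refl (toℕ a)) ⟩
      rdiff (suc (toℕ a)) (suc (suc (toℕ a))) l
        ∎
      where
      open ≡-Reasoning
      F : ℕ → Poly t
      F i = cm (suc i) (rdiff (suc i) (suc (suc i)))
      off-diagonal : ∀ i → i ≢ toℕ a → F i a l ≡ + 0
      off-diagonal i i≢a with toℕ a ≡ᵇ i | ≡ᵇ-reflects (toℕ a) i
      ... | true | ofʸ a≡i = ⊥-elim (i≢a (sym a≡i))
      ... | false | _ = refl

    boundary-level : hPoly ⊕ fR (dual D) 1 ≈ star hPoly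
    boundary-level a l = begin
      hPoly a l + fR (dual D) 1 a l
        ≡⟨ cong (λ z → hPoly a l + z) (trans (fR-dual-one a l) (rdiff-adjacent (toℕ a) l)) ⟩
      hPoly a l + rcoef (toℕ a) (suc (toℕ a)) (toℕ l)
        ≡⟨ boundary-coefficient (toℕ a) (toℕ l) ⟩
      (if suc (toℕ a) ≡ᵇ toℕ l then + 1 else + 0)
        ≡⟨ cong (λ c → if c then + 1 else + 0) (sym opposite-test) ⟩
      (if toℕ (opposite a) ≡ᵇ toℕ (opposite l) then + 1 else + 0)
        ≡⟨ sym (if-float -_ (toℕ (opposite a) ≡ᵇ toℕ (opposite l))) ⟩
      - hPoly (opposite a) (opposite l)
        ∎
      where
      open ≡-Reasoning
      opposite-test : (toℕ (opposite a) ≡ᵇ toℕ (opposite l)) ≡ (suc (toℕ a) ≡ᵇ toℕ l)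
      opposite-test = trans (cong₂ _≡ᵇ_ (Finₚ.opposite-prop a) (Finₚ.opposite-prop l))
        (≡ᵇ-reflect (Finₚ.toℕ<n a) (s≤s⁻¹ (Finₚ.toℕ<n l)))

    fT-mirror : fT (dual D) ≈ star (fT D)
    fT-mirror = begin
      hPoly ⊕ sumP (map (λ s → fR (dual D) (suc s)) (upTo (maxH (dual D))))
        ≡⟨ cong (λ n → hPoly ⊕ sumP (map (λ s → fR (dual D) (suc s)) (upTo n))) (maxH-dual D) ⟩
      hPoly ⊕ sumP (map (λ s → fR (dual D) (suc s)) (upTo (suc M)))
        ≡⟨ cong (λ Ps → hPoly ⊕ sumP Ps) (map-upTo-suc (λ s → fR (dual D) (suc s)) M) ⟩
      hPoly ⊕ (fR (dual D) 1 ⊕ sumP (map (λ s → fR (dual D) (suc (suc s))) (upTo M)))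
        ≈⟨ ≈-sym (assoc hPoly (fR (dual D) 1) _) ⟩
      (hPoly ⊕ fR (dual D) 1) ⊕ sumP (map (λ s → fR (dual D) (suc (suc s))) (upTo M))
        ≈⟨ ∙-cong boundary-level (sumP-cong (upTo M) (λ {s} _ → fR-mirror s)) ⟩
      star hPoly ⊕ sumP (map (λ s → star (fR D (suc s))) (upTo M))
        ≈⟨ ∙-cong (≈-refl {star hPoly}) (≈-sym (star-sumP (λ s → fR D (suc s)) (upTo M))) ⟩
      star hPoly ⊕ star (sumP (map (λ s → fR D (suc s)) (upTo M)))
        ≈⟨ ≈-sym (star-⊕ hPoly (sumP (map (λ s → fR D (suc s)) (upTo M)))) ⟩
      star (fT D)
        ∎
      where
      open ≈-Reasoning polySetoid
      M = maxH D

lemma4p4 : (t : ℕ) (D : Diagram t) → Boundary D →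
    (a : Fin t) (l : Fin (suc t)) → fT (dual D) a l ≡ star (fT D) a l
lemma4p4 t D _ = Mirror.Dual.fT-mirror t D
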